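{- Let $k\geqslant 5$ and let $G$ be a $C_k$-saturated graph. Let $P=u_0u_1\ldots u_\ell$ be a path in $G$ with $\ell\geqslant 2$ all of whose vertices have degree $2$ in $G$. Then $u_0$ and $u_\ell$ have no common neighbor in $V(G)\setminus V(P)$.
   Context: All graphs are finite, simple, undirected. $C_k$ is the cycle on $k$ vertices. $G$ is $C_k$-saturated if $G$ contains no subgraph isomorphic to $C_k$ and adding any edge between two nonadjacent vertices creates one. -}

module Defs where

open import Data.Nat using (ℕ; zero; suc; _≤_; _<_)
open import Data.Fin using (Fin; toℕ; fromℕ; inject₁; fromℕ<)
import Data.Fin as F
open import Data.Bool using (Bool; true; false; T)
open import Data.List using (length; filter)
open import Data.List.Base using (allFin)
open import Data.Product using (Σ; ∃; _×_; _,_)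
open import Data.Sum using (_⊎_)
open import Relation.Nullary using (¬_)
open import Relation.Binary.PropositionalEquality using (_≡_; _≢_)
open import Function.Definitions using (Injective)
open import Data.Bool.Properties using (T?)
open import Data.Nat.DivMod using (_%_; m%n<n)

record Graph (n : ℕ) : Set where
  field
    adj   : Fin n → Fin n → Bool
    sym   : ∀ u v → adj u v ≡ adj v u
    irrefl : ∀ v → adj v v ≡ false
open Graph public

Adj : {n : ℕ} → Graph n → Fin n → Fin n → Set
Adj G u v = T (adj G u v)

degree : {n : ℕ} → Graph n → Fin n → ℕ
degree {n} G v = length (filter (λ w → T? (adj G v w)) (allFin n))

cycSucc : {k : ℕ} → Fin k → Fin k
cycSucc {suc k} i = fromℕ< (m%n<n (suc (toℕ i)) (suc k))

CycleIn : {n : ℕ} → (Fin n → Fin n → Set) → ℕ → Set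
CycleIn {n} E k = Σ (Fin k → Fin n) λ f → Injective _≡_ _≡_ f × (∀ i → E (f i) (f (cycSucc i)))

HasCycle : {n : ℕ} → Graph n → ℕ → Set
HasCycle G k = CycleIn (Adj G) k

AdjPlus : {n : ℕ} → Graph n → Fin n → Fin n → Fin n → Fin n → Set
AdjPlus G u v x y = Adj G x y ⊎ ((x ≡ u × y ≡ v) ⊎ (x ≡ v × y ≡ u))

Saturated : {n : ℕ} → Graph n → ℕ → Set
Saturated {n} G k =
  ¬ HasCycle G k ×
  (∀ (u v : Fin n) → u ≢ v → ¬ Adj G u v → CycleIn (AdjPlus G u v) k)

IsPath : {n ℓ : ℕ} → Graph n → (Fin (suc ℓ) → Fin n) → Set
IsPath {n} {ℓ} G u = Injective _≡_ _≡_ u × (∀ (i : Fin ℓ) → Adj G (u (inject₁ i)) (u (F.suc i)))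

{-# OPTIONS --safe #-}
-- Closing the path with w gives a cycle D = w u₀ … u_ℓ of length ℓ + 2 all of whose vertices except w
-- have degree 2. For a = u₀ and b = u_d with d ≥ 2, ab is a non-edge, so saturation yields a k-cycle
-- through the new edge ab. In G + ab every vertex of D other than w, a, b still has only its two
-- D-neighbours, so the cycle is forced along D: leaving b towards a would close a cycle of length
-- d + 1 < k, so from b it runs through u_{d+1}, …, u_ℓ to w, and likewise the other cycle-neighbour of a
-- is w. Hence k = ℓ − d + 3. Taking d = 2 gives k = ℓ + 1, which is 3 < 5 when ℓ = 2; for ℓ ≥ 3,
-- taking d = 3 as well gives k = ℓ, a contradiction.
module Submission where

open import Defs hiding (sym)
open import Data.Nat using (ℕ; zero; suc; _+_; _*_; _∸_; _≤_; _<_; z≤n; s≤s; z<s; s<s; NonZero; >-nonZero)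
open import Data.Nat.Properties
open import Data.Nat.DivMod using (_%_; _/_; m%n<n; m≡m%n+[m/n]*n; m%n%n≡m%n; %-distribˡ-+; m≤n⇒m%n≡m; m<n⇒m%n≡m; n%n≡0; [m+n]%n≡m%n)
open import Data.Nat.Divisibility using (_∣_; divides; ∣m+n∣m⇒∣n; n∣m*n; >⇒∤)
open import Data.Nat.Tactic.RingSolver using (solve-∀)
open import Data.Fin using (Fin; zero; suc; toℕ; fromℕ; fromℕ<; inject₁)
open import Data.Fin.Properties using (toℕ-injective; toℕ-fromℕ<; toℕ-fromℕ; toℕ-inject₁; toℕ<n; ¬∀⟶∃¬)
open import Data.Fin.Relation.Unary.Top using (view; ‵fromℕ; ‵inject₁)
import Data.Vec.Functional as Vector
open import Data.Bool using (T)
open import Data.Bool.Properties using (T?)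
open import Data.List using (List; []; _∷_; length; filter; allFin)
open import Data.List.Membership.Propositional using (_∈_)
open import Data.List.Membership.Propositional.Properties using (∈-filter⁺; ∈-allFin)
open import Data.List.Relation.Unary.Any using (here; there)
open import Data.Product using (Σ; ∃; _×_; _,_; proj₁; proj₂)
open import Data.Sum using (_⊎_; inj₁; inj₂; [_,_]′)
open import Data.Empty using (⊥-elim)
open import Function.Base using (_∘_)
open import Function.Definitions using (Injective)
open import Relation.Nullary using (¬_; Dec)
open import Relation.Binary.PropositionalEquality using (_≡_; _≢_; refl; sym; trans; cong; subst; module ≡-Reasoning)

open ≡-Reasoning

[1+m%n]%n≡[1+m]%n : ∀ m n .{{_ : NonZero n}} → suc (m % n) % n ≡ suc m % n
[1+m%n]%n≡[1+m]%n m n = begin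
  (1 + m % n) % n          ≡⟨ %-distribˡ-+ 1 (m % n) n ⟩
  (1 % n + m % n % n) % n  ≡⟨ cong (λ r → (1 % n + r) % n) (m%n%n≡m%n m n) ⟩
  (1 % n + m % n) % n      ≡⟨ %-distribˡ-+ 1 m n ⟨
  (1 + m) % n              ∎

[m+n]%o≡n%o⇒o∣m : ∀ m n o .{{_ : NonZero o}} → (m + n) % o ≡ n % o → o ∣ m
[m+n]%o≡n%o⇒o∣m m n o eq = ∣m+n∣m⇒∣n (divides ((m + n) / o) (+-cancelʳ-≡ (n % o) _ _ sums)) (n∣m*n (n / o))
  where
  rearrange : ∀ a b c → a + b + c ≡ b + (c + a)
  rearrange = solve-∀
  sums : n / o * o + m + n % o ≡ (m + n) / o * o + n % o
  sums = begin
    n / o * o + m + n % o          ≡⟨ rearrange (n / o * o) m (n % o) ⟩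
    m + (n % o + n / o * o)        ≡⟨ cong (m +_) (m≡m%n+[m/n]*n n o) ⟨
    m + n                          ≡⟨ m≡m%n+[m/n]*n (m + n) o ⟩
    (m + n) % o + (m + n) / o * o  ≡⟨ cong (_+ (m + n) / o * o) eq ⟩
    n % o + (m + n) / o * o        ≡⟨ +-comm (n % o) _ ⟩
    (m + n) / o * o + n % o        ∎

m∸n≡1+[m∸1+n] : ∀ {m n} → n < m → m ∸ n ≡ suc (m ∸ suc n)
m∸n≡1+[m∸1+n] {suc m} {zero}  _         = refl
m∸n≡1+[m∸1+n] {suc m} {suc n} (s<s n<m) = m∸n≡1+[m∸1+n] n<m

toℕ-cycSucc : ∀ {k} (i : Fin (suc k)) → toℕ (cycSucc i) ≡ suc (toℕ i) % suc k
toℕ-cycSucc i = toℕ-fromℕ< _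

cycSucc-inject₁ : ∀ {k} (i : Fin k) → cycSucc (inject₁ i) ≡ suc i
cycSucc-inject₁ {k} i = toℕ-injective (begin
  toℕ (cycSucc (inject₁ i))      ≡⟨ toℕ-cycSucc (inject₁ i) ⟩
  suc (toℕ (inject₁ i)) % suc k  ≡⟨ cong (λ r → suc r % suc k) (toℕ-inject₁ i) ⟩
  suc (toℕ i) % suc k            ≡⟨ m≤n⇒m%n≡m (toℕ<n i) ⟩
  suc (toℕ i)                    ∎)

cycSucc-fromℕ : ∀ k → cycSucc (fromℕ k) ≡ zero
cycSucc-fromℕ k = toℕ-injective (begin
  toℕ (cycSucc (fromℕ k))      ≡⟨ toℕ-cycSucc (fromℕ k) ⟩
  suc (toℕ (fromℕ k)) % suc k  ≡⟨ cong (λ r → suc r % suc k) (toℕ-fromℕ k) ⟩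
  suc k % suc k                ≡⟨ n%n≡0 (suc k) ⟩
  0                            ∎)

distinct-from-offsets : ∀ {V : Set} {k} (f : ℕ → V) →
  (∀ {t} m → 0 < t → t < suc k → f m ≢ f (t + m)) →
  ∀ {x y} → x < y → y < x + suc k → f x ≢ f y
distinct-from-offsets f offset {x} {y} x<y y<x+L fx≡fy =
  offset x (m<n⇒0<n∸m x<y) (m<n+o⇒m∸n<o y x y<x+L)
    (trans fx≡fy (cong f (sym (m∸n+n≡m (<⇒≤ x<y)))))

-- A cycle of length L, read as an L-periodic walk on ℕ that is injective on windows of length L.
record UnrolledCycle {V : Set} (E : V → V → Set) (L : ℕ) : Set where
  field
    at       : ℕ → V
    step     : ∀ m → E (at m) (at (suc m))
    periodic : ∀ m → at (m + L) ≡ at m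
    distinct : ∀ {x y} → x < y → y < x + L → at x ≢ at y

  distinct-offset : ∀ {t} m → 0 < t → t < L → at m ≢ at (t + m)
  distinct-offset {t} m 0<t t<L = distinct (m<n+m m 0<t) (subst (_< m + L) (+-comm m t) (+-monoʳ-< m t<L))

  no-return : 2 < L → ∀ m → at m ≢ at (2 + m)
  no-return 2<L m = distinct-offset m z<s 2<L

  periodic-* : ∀ q m → at (q * L + m) ≡ at m
  periodic-* zero    m = refl
  periodic-* (suc q) m = begin
    at (L + q * L + m)  ≡⟨ cong at (rearrange L (q * L) m) ⟩
    at (q * L + m + L)  ≡⟨ periodic (q * L + m) ⟩
    at (q * L + m)      ≡⟨ periodic-* q m ⟩
    at m                ∎
    where
    rearrange : ∀ a b c → a + b + c ≡ b + c + a
    rearrange = solve-∀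

open UnrolledCycle

module _ {V : Set} {E : V → V → Set} where

  next : ∀ {L} → UnrolledCycle E L → UnrolledCycle E L
  next c = record
    { at       = λ m → at c (suc m)
    ; step     = λ m → step c (suc m)
    ; periodic = λ m → periodic c (suc m)
    ; distinct = λ x<y y<x+L → distinct c (s<s x<y) (s<s y<x+L)
    }

  module _ (E-sym : ∀ {x y} → E x y → E y x) where

    reverse : ∀ {k} → UnrolledCycle E (suc k) → UnrolledCycle E (suc k)
    reverse {k} c = record
      { at       = at′
      ; step     = λ m → E-sym (subst (E (at′ (suc m))) (back-step m) (step c (k + m * k)))
      ; periodic = λ m → trans (cong (at c) (shift m k)) (periodic-* c k (m * k))
      ; distinct = distinct-from-offsets at′ offset
      }
      where
      -- m * k ≡ - m modulo the period suc k
      at′ : ℕ → V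
      at′ m = at c (m * k)
      back-step : ∀ m → at c (suc (k + m * k)) ≡ at′ m
      back-step m = trans (cong (at c) (+-comm (suc k) (m * k))) (periodic c (m * k))
      shift : ∀ m k → (m + suc k) * k ≡ k * suc k + m * k
      shift = solve-∀
      unwind : ∀ t k x → t * suc k + x * k ≡ t + (t + x) * k
      unwind = solve-∀
      offset : ∀ {t} m → 0 < t → t < suc k → at′ m ≢ at′ (t + m)
      offset {t} m 0<t t<L eq = distinct-offset c ((t + m) * k) 0<t t<L (begin
        at c ((t + m) * k)        ≡⟨ eq ⟨
        at c (m * k)              ≡⟨ periodic-* c t (m * k) ⟨
        at c (t * suc k + m * k)  ≡⟨ cong (at c) (unwind t k m) ⟩
        at c (t + (t + m) * k)    ∎)

    reverse-last : ∀ {k} (c : UnrolledCycle E (suc k)) → 0 < k → at (reverse c) k ≡ at c 1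
    reverse-last {suc k} c _ = trans (cong (at c) (square k)) (periodic-* c k 1)
      where
      square : ∀ k → suc k * suc k ≡ k * suc (suc k) + 1
      square = solve-∀

module _ {n k : ℕ} {E : Fin n → Fin n → Set} (cyc : CycleIn E (suc k)) (i : Fin (suc k)) where

  private
    L = suc k
    f = proj₁ cyc
    f-inj = proj₁ (proj₂ cyc)
    f-adj = proj₂ (proj₂ cyc)

    pos : ℕ → Fin L
    pos m = fromℕ< (m%n<n (toℕ i + m) L)

    toℕ-pos : ∀ m → toℕ (pos m) ≡ (toℕ i + m) % L
    toℕ-pos m = toℕ-fromℕ< _

    pos₀ : pos 0 ≡ i
    pos₀ = toℕ-injective (begin
      toℕ (pos 0)      ≡⟨ toℕ-pos 0 ⟩
      (toℕ i + 0) % L  ≡⟨ cong (_% L) (+-identityʳ (toℕ i)) ⟩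
      toℕ i % L        ≡⟨ m<n⇒m%n≡m (toℕ<n i) ⟩
      toℕ i            ∎)

    cycSucc-pos : ∀ m → cycSucc (pos m) ≡ pos (suc m)
    cycSucc-pos m = toℕ-injective (begin
      toℕ (cycSucc (pos m))      ≡⟨ toℕ-cycSucc (pos m) ⟩
      suc (toℕ (pos m)) % L      ≡⟨ cong (λ r → suc r % L) (toℕ-pos m) ⟩
      suc ((toℕ i + m) % L) % L  ≡⟨ [1+m%n]%n≡[1+m]%n (toℕ i + m) L ⟩
      suc (toℕ i + m) % L        ≡⟨ cong (_% L) (+-suc (toℕ i) m) ⟨
      (toℕ i + suc m) % L        ≡⟨ toℕ-pos (suc m) ⟨
      toℕ (pos (suc m))          ∎)

    pos-periodic : ∀ m → pos (m + L) ≡ pos m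
    pos-periodic m = toℕ-injective (begin
      toℕ (pos (m + L))      ≡⟨ toℕ-pos (m + L) ⟩
      (toℕ i + (m + L)) % L  ≡⟨ cong (_% L) (+-assoc (toℕ i) m L) ⟨
      (toℕ i + m + L) % L    ≡⟨ [m+n]%n≡m%n (toℕ i + m) L ⟩
      (toℕ i + m) % L        ≡⟨ toℕ-pos m ⟨
      toℕ (pos m)            ∎)

    pos-offset : ∀ {t} m → 0 < t → t < L → pos m ≢ pos (t + m)
    pos-offset {t} m 0<t t<L eq = >⇒∤ {{>-nonZero 0<t}} t<L ([m+n]%o≡n%o⇒o∣m t (toℕ i + m) L (begin
      (t + (toℕ i + m)) % L  ≡⟨ cong (_% L) (+-comm t (toℕ i + m)) ⟩
      (toℕ i + m + t) % L    ≡⟨ cong (_% L) (+-assoc (toℕ i) m t) ⟩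
      (toℕ i + (m + t)) % L  ≡⟨ cong (λ s → (toℕ i + s) % L) (+-comm m t) ⟩
      (toℕ i + (t + m)) % L  ≡⟨ toℕ-pos (t + m) ⟨
      toℕ (pos (t + m))      ≡⟨ cong toℕ eq ⟨
      toℕ (pos m)            ≡⟨ toℕ-pos m ⟩
      (toℕ i + m) % L        ∎))

  unroll : UnrolledCycle E L
  unroll = record
    { at       = λ m → f (pos m)
    ; step     = λ m → subst (λ j → E (f (pos m)) (f j)) (cycSucc-pos m) (f-adj (pos m))
    ; periodic = λ m → cong f (pos-periodic m)
    ; distinct = distinct-from-offsets (λ m → f (pos m)) (λ m 0<t t<L → pos-offset m 0<t t<L ∘ f-inj)
    }

  unroll-at₀ : at unroll 0 ≡ f i
  unroll-at₀ = cong f pos₀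

  unroll-at₁ : at unroll 1 ≡ f (cycSucc i)
  unroll-at₁ = cong f (trans (sym (cycSucc-pos 0)) (cong cycSucc pos₀))

  unroll-image : ∀ m → Σ (Fin L) λ j → at unroll m ≡ f j
  unroll-image m = pos m , refl

module _ {V : Set} (E : V → V → Set) where

  Bare : (ℕ → V) → ℕ → Set
  Bare p M = ∀ j → suc j < M → ∀ {y} → E (p (suc j)) y → y ≡ p j ⊎ y ≡ p (2 + j)

module _ {V : Set} {E : V → V → Set} where

  Bare-drop : ∀ {p N} s {M} → Bare E p N → s + M ≤ N → Bare E (λ j → p (s + j)) M
  Bare-drop {p} s {M} bare s+M≤N j sj<M {y} e =
    subst (λ x → y ≡ p (s + j) ⊎ y ≡ p x) (sym (trans (+-suc s (suc j)) (cong suc (+-suc s j))))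
      (bare (s + j) inner (subst (λ x → E (p x) y) (+-suc s j) e))
    where
    inner : suc (s + j) < _
    inner = <-≤-trans (subst (_< s + M) (+-suc s j) (+-monoʳ-< s sj<M)) s+M≤N

  Bare-reverse : ∀ {p M} → Bare E p M → Bare E (λ j → p (M ∸ j)) M
  Bare-reverse {p} {M} bare j sj<M {y} e =
    [ inj₂ , (λ y≡p2+i → inj₁ (trans y≡p2+i (cong p (sym M∸j)))) ]′
      (bare i i<M (subst (λ x → E (p x) y) M∸sj e))
    where
    i = M ∸ suc (suc j)
    M∸sj : M ∸ suc j ≡ suc i
    M∸sj = m∸n≡1+[m∸1+n] sj<M
    M∸j : M ∸ j ≡ 2 + i
    M∸j = trans (m∸n≡1+[m∸1+n] (<-trans (n<1+n j) sj<M)) (cong suc M∸sj)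
    i<M : suc i < M
    i<M = subst (_< M) M∸sj (∸-monoʳ-< z<s (<⇒≤ sj<M))

  follow-bare : ∀ {p q : ℕ → V} {M} → Bare E p M →
    (∀ m → E (q m) (q (suc m))) → (∀ m → q m ≢ q (2 + m)) →
    q 0 ≡ p 0 → q 1 ≡ p 1 → ∀ {j} → j ≤ M → q j ≡ p j
  follow-bare _ _ _ q₀ _ {zero} _ = q₀
  follow-bare {p} {q} {M} bare q-step q-no-return q₀ q₁ {suc j} j<M = proj₂ (along j<M)
    where
    along : ∀ {j} → j < M → q j ≡ p j × q (suc j) ≡ p (suc j)
    along {zero}  _    = q₀ , q₁
    along {suc j} sj<M with along (<-trans (n<1+n j) sj<M)
    ... | qj , qsj with bare j sj<M (subst (λ x → E x (q (2 + j))) qsj (q-step (suc j)))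
    ...   | inj₁ q2+j≡pj  = ⊥-elim (q-no-return j (trans qj (sym q2+j≡pj)))
    ...   | inj₂ q2+j≡p2+j = qsj , q2+j≡p2+j

  -- Leaving along p would bring c to p M = at c N already after M < N steps.
  exit-off-bare-path : ∀ {L} (c : UnrolledCycle E L) {p : ℕ → V} {M N : ℕ} {z : V} →
    Bare E p M → 0 < M → M < N → N < L → at c 0 ≡ p 0 → at c N ≡ p M →
    (∀ {y} → E (p 0) y → y ≡ p M ⊎ y ≡ p 1 ⊎ y ≡ z) → at c 1 ≡ z
  exit-off-bare-path c bare 0<M M<N N<L c₀ c-N exits with exits (subst (λ x → E x (at c 1)) c₀ (step c 0))
  ... | inj₁ c₁≡pM        = ⊥-elim (distinct c (≤-<-trans 0<M M<N) (m<n⇒m<1+n N<L) (trans c₁≡pM (sym c-N)))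
  ... | inj₂ (inj₂ c₁≡z)  = c₁≡z
  ... | inj₂ (inj₁ c₁≡p₁) = ⊥-elim (distinct c M<N (<-≤-trans N<L (m≤n+m _ _))
    (trans (follow-bare bare (step c) (no-return c (≤-<-trans (≤-<-trans 0<M M<N) N<L)) c₀ c₁≡p₁ ≤-refl) (sym c-N)))

module _ {A : Set} where

  ∈-pair : ∀ {p q y : A} → y ∈ p ∷ q ∷ [] → y ≡ p ⊎ y ≡ q
  ∈-pair (here y≡p)         = inj₁ y≡p
  ∈-pair (there (here y≡q)) = inj₂ y≡q

  length≡2⇒∈⇒≡⊎≡ : ∀ {xs : List A} {x z y : A} → length xs ≡ 2 →
    x ∈ xs → z ∈ xs → x ≢ z → y ∈ xs → y ≡ x ⊎ y ≡ z
  length≡2⇒∈⇒≡⊎≡ {_ ∷ _ ∷ []} refl x∈ z∈ x≢z y∈ with ∈-pair x∈ | ∈-pair z∈ | ∈-pair y∈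
  ... | inj₁ refl | inj₁ refl | _        = ⊥-elim (x≢z refl)
  ... | inj₂ refl | inj₂ refl | _        = ⊥-elim (x≢z refl)
  ... | inj₁ refl | inj₂ refl | inj₁ y≡x = inj₁ y≡x
  ... | inj₁ refl | inj₂ refl | inj₂ y≡z = inj₂ y≡z
  ... | inj₂ refl | inj₁ refl | inj₁ y≡z = inj₂ y≡z
  ... | inj₂ refl | inj₁ refl | inj₂ y≡x = inj₁ y≡x

module _ {n : ℕ} (G : Graph n) where

  Adj-sym : ∀ {x y} → Adj G x y → Adj G y x
  Adj-sym {x} {y} = subst T (Graph.sym G x y)

  degree≡2⇒neighbours : ∀ {v x z y} → degree G v ≡ 2 →
    Adj G v x → Adj G v z → x ≢ z → Adj G v y → y ≡ x ⊎ y ≡ z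
  degree≡2⇒neighbours {v} deg vx vz x≢z vy =
    length≡2⇒∈⇒≡⊎≡ deg (neighbour vx) (neighbour vz) x≢z (neighbour vy)
    where
    neighbour : ∀ {y} → Adj G v y → y ∈ filter (λ w → T? (adj G v w)) (allFin n)
    neighbour {y} = ∈-filter⁺ (λ w → T? (adj G v w)) (∈-allFin y)

  module _ {u v : Fin n} where

    AdjPlus-sym : ∀ {x y} → AdjPlus G u v x y → AdjPlus G u v y x
    AdjPlus-sym (inj₁ xy)                = inj₁ (Adj-sym xy)
    AdjPlus-sym (inj₂ (inj₁ (x≡u , y≡v))) = inj₂ (inj₂ (y≡v , x≡u))
    AdjPlus-sym (inj₂ (inj₂ (x≡v , y≡u))) = inj₂ (inj₁ (y≡u , x≡v))

    AdjPlus-away : ∀ {x y} → x ≢ u → x ≢ v → AdjPlus G u v x y → Adj G x y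
    AdjPlus-away _   _   (inj₁ xy)               = xy
    AdjPlus-away x≢u _   (inj₂ (inj₁ (x≡u , _))) = ⊥-elim (x≢u x≡u)
    AdjPlus-away _   x≢v (inj₂ (inj₂ (x≡v , _))) = ⊥-elim (x≢v x≡v)

    AdjPlus-from-u : ∀ {y} → AdjPlus G u v u y → Adj G u y ⊎ y ≡ v
    AdjPlus-from-u (inj₁ uy)                = inj₁ uy
    AdjPlus-from-u (inj₂ (inj₁ (_ , y≡v)))   = inj₂ y≡v
    AdjPlus-from-u (inj₂ (inj₂ (u≡v , y≡u))) = inj₂ (trans y≡u u≡v)

    AdjPlus-from-v : ∀ {y} → AdjPlus G u v v y → Adj G v y ⊎ y ≡ u
    AdjPlus-from-v (inj₁ vy)                = inj₁ vy
    AdjPlus-from-v (inj₂ (inj₁ (v≡u , y≡v))) = inj₂ (trans y≡v v≡u)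
    AdjPlus-from-v (inj₂ (inj₂ (_ , y≡u)))   = inj₂ y≡u

    Bare-AdjPlus : ∀ {p M} → Bare (Adj G) p M →
      (∀ j → suc j < M → p (suc j) ≢ u × p (suc j) ≢ v) → Bare (AdjPlus G u v) p M
    Bare-AdjPlus bare inner-avoids j sj<M =
      bare j sj<M ∘ AdjPlus-away (proj₁ (inner-avoids j sj<M)) (proj₂ (inner-avoids j sj<M))

  closing-cycle : ∀ {ℓ} {u : Fin (suc ℓ) → Fin n} {w : Fin n} → IsPath G u → (∀ i → w ≢ u i) →
    Adj G w (u zero) → Adj G w (u (fromℕ ℓ)) → CycleIn (Adj G) (2 + ℓ)
  closing-cycle {ℓ} {u} {w} (u-inj , u-adj) w∉u w~u₀ w~uℓ = f , f-inj , f-adj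
    where
    f : Fin (2 + ℓ) → Fin n
    f = w Vector.∷ u
    f-inj : Injective _≡_ _≡_ f
    f-inj {zero}  {zero}  _  = refl
    f-inj {zero}  {suc j} eq = ⊥-elim (w∉u j eq)
    f-inj {suc i} {zero}  eq = ⊥-elim (w∉u i (sym eq))
    f-inj {suc i} {suc j} eq = cong suc (u-inj eq)
    f-adj : ∀ i → Adj G (f i) (f (cycSucc i))
    f-adj zero = subst (Adj G w ∘ f) (sym (cycSucc-inject₁ zero)) w~u₀
    f-adj (suc j) with view j
    ... | ‵fromℕ      = subst (Adj G (u (fromℕ ℓ)) ∘ f) (sym (cycSucc-fromℕ (suc ℓ))) (Adj-sym w~uℓ)
    ... | ‵inject₁ j′ = subst (Adj G (u (inject₁ j′)) ∘ f) (sym (cycSucc-inject₁ (suc j′))) (u-adj j′)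

module _ {n : ℕ} (G : Graph n) {a b : Fin n} where

  cycle-uses-added-edge : ∀ {K} → ¬ HasCycle G K → (cyc : CycleIn (AdjPlus G a b) K) →
    let f = proj₁ cyc in ∃ λ i → (f i ≡ a × f (cycSucc i) ≡ b) ⊎ (f i ≡ b × f (cycSucc i) ≡ a)
  cycle-uses-added-edge {K} no-cycle (f , f-inj , f-adj) = i , off-G (f-adj i)
    where
    in-G? : ∀ i → Dec (Adj G (f i) (f (cycSucc i)))
    in-G? i = T? (adj G (f i) (f (cycSucc i)))
    some-edge-off-G : ∃ λ i → ¬ Adj G (f i) (f (cycSucc i))
    some-edge-off-G = ¬∀⟶∃¬ K _ in-G? (λ all-in-G → no-cycle (f , f-inj , all-in-G))
    i = proj₁ some-edge-off-G
    off-G : AdjPlus G a b (f i) (f (cycSucc i)) → (f i ≡ a × f (cycSucc i) ≡ b) ⊎ (f i ≡ b × f (cycSucc i) ≡ a)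
    off-G (inj₁ in-G) = ⊥-elim (proj₂ some-edge-off-G in-G)
    off-G (inj₂ added) = added

  added-edge-cycle : ∀ {k} → Saturated G (suc k) → a ≢ b → ¬ Adj G a b →
    Σ (UnrolledCycle (AdjPlus G a b) (suc k)) λ C → at C 0 ≡ a × at C 1 ≡ b
  added-edge-cycle {k} (no-cycle , saturated) a≢b a≁b = orient (cycle-uses-added-edge no-cycle cyc)
    where
    cyc = saturated a b a≢b a≁b
    f = proj₁ cyc
    C : Fin (suc k) → UnrolledCycle (AdjPlus G a b) (suc k)
    C = unroll {E = AdjPlus G a b} cyc
    C₀ : ∀ i → at (C i) 0 ≡ f i
    C₀ = unroll-at₀ {E = AdjPlus G a b} cyc
    C₁ : ∀ i → at (C i) 1 ≡ f (cycSucc i)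
    C₁ = unroll-at₁ {E = AdjPlus G a b} cyc
    orient : (∃ λ i → (f i ≡ a × f (cycSucc i) ≡ b) ⊎ (f i ≡ b × f (cycSucc i) ≡ a)) →
      Σ (UnrolledCycle (AdjPlus G a b) (suc k)) λ C → at C 0 ≡ a × at C 1 ≡ b
    orient (i , inj₁ (fi≡a , fi+1≡b)) = C i , trans (C₀ i) fi≡a , trans (C₁ i) fi+1≡b
    orient (i , inj₂ (fi≡b , fi+1≡a)) = reverse (AdjPlus-sym G) (next (C i)) ,
      trans (C₁ i) fi+1≡a ,
      trans (cong (at (C i) ∘ suc) (+-identityʳ k)) (trans (periodic (C i) 0) (trans (C₀ i) fi≡b))

Pendant : ∀ {n L} (G : Graph n) → UnrolledCycle (Adj G) L → Set
Pendant G D = ∀ m → at D m ≢ at D 0 → degree G (at D m) ≡ 2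

pendant-closure : ∀ {n ℓ} (G : Graph n) {u : Fin (suc ℓ) → Fin n} {w : Fin n} →
  IsPath G u → (∀ i → degree G (u i) ≡ 2) → (∀ i → w ≢ u i) →
  Adj G w (u zero) → Adj G w (u (fromℕ ℓ)) → Σ (UnrolledCycle (Adj G) (2 + ℓ)) (Pendant G)
pendant-closure G {u} u-path u-deg w∉u w~u₀ w~uℓ = D , pendant
  where
  cyc = closing-cycle G u-path w∉u w~u₀ w~uℓ
  D = unroll {E = Adj G} cyc zero
  pendant : Pendant G D
  pendant m m≢w with unroll-image {E = Adj G} cyc zero m
  ... | zero  , eq = ⊥-elim (m≢w (trans eq (sym (unroll-at₀ {E = Adj G} cyc zero))))
  ... | suc i , eq = subst (λ x → degree G x ≡ 2) (sym eq) (u-deg i)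

module Chord {n : ℕ} (G : Graph n) {d e : ℕ} (1<d : 1 < d)
  (D : UnrolledCycle (Adj G) (2 + (d + e))) (pendant : Pendant G D) where

  private
    L = 2 + (d + e)
    v = at D
    0<d : 0 < d
    0<d = <-trans z<s 1<d
    1<L : 1 < L
    1<L = s≤s (s≤s z≤n)
    2<L : 2 < L
    2<L = s≤s (s≤s (≤-trans (<⇒≤ 1<d) (m≤m+n d e)))
    d<L : d < L
    d<L = s≤s (≤-trans (m≤m+n d e) (n≤1+n (d + e)))
    1+d<L : suc d < L
    1+d<L = s≤s (s≤s (m≤m+n d e))
    1+e<L : suc e < L
    1+e<L = s≤s (s≤s (m≤n+m e d))

  a : Fin n
  a = v 1
  b : Fin n
  b = v (suc d)
  E : Fin n → Fin n → Set
  E = AdjPlus G a b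

  D-bare : Bare (Adj G) v L
  D-bare j sj<L = degree≡2⇒neighbours G (pendant (suc j) (distinct D z<s sj<L ∘ sym))
    (Adj-sym G (step D j)) (step D (suc j)) (no-return D 2<L j)

  a≢b : a ≢ b
  a≢b = distinct D (s<s 0<d) (s<s d<L)

  a≁b : ¬ Adj G a b
  a≁b a~b with D-bare 0 1<L a~b
  ... | inj₁ b≡v₀ = distinct D z<s 1+d<L (sym b≡v₀)
  ... | inj₂ b≡v₂ = distinct D (s<s 1<d) (m<n⇒m<1+n (m<n⇒m<1+n 1+d<L)) (sym b≡v₂)

  up : ℕ → Fin n
  up j = v (suc j)
  down : ℕ → Fin n
  down j = up (d ∸ j)
  around : ℕ → Fin n
  around j = v (suc d + j)

  up-bare : Bare E up d
  up-bare = Bare-AdjPlus G (Bare-drop {E = Adj G} 1 D-bare d<L) λ j sj<d →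
    (λ v₂₊ⱼ≡a → distinct D (s<s z<s) (s<s (<-trans sj<d d<L)) (sym v₂₊ⱼ≡a)) ,
    distinct D (s<s sj<d) (<-≤-trans 1+d<L (m≤n+m L (2 + j)))

  down-bare : Bare E down d
  down-bare = Bare-reverse {E = E} up-bare

  around-bare : Bare E around (suc e)
  around-bare = Bare-AdjPlus G (Bare-drop {E = Adj G} (suc d) D-bare (s≤s (≤-reflexive (+-suc d e)))) λ j sj<1+e →
    (λ around≡a → distinct D (s<s (<-≤-trans 0<d (m≤m+n d (suc j))))
       (s<s (s≤s (subst (d + suc j ≤_) (+-suc d e) (+-monoʳ-≤ d (<⇒≤ sj<1+e))))) (sym around≡a)) ,
    distinct D (m<m+n (suc d) z<s) (+-monoʳ-< (suc d) (<-trans sj<1+e 1+e<L)) ∘ sym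

  down-end : down d ≡ a
  down-end = cong (v ∘ suc) (n∸n≡0 d)

  around-end : around (suc e) ≡ v 0
  around-end = trans (cong (v ∘ suc) (+-suc d e)) (periodic D 0)

  a-exits : ∀ {y} → E (up 0) y → y ≡ up d ⊎ y ≡ up 1 ⊎ y ≡ v 0
  a-exits e with AdjPlus-from-u G {u = a} {v = b} e
  ... | inj₂ y≡b = inj₁ y≡b
  ... | inj₁ a~y with D-bare 0 1<L a~y
  ...   | inj₁ y≡v₀ = inj₂ (inj₂ y≡v₀)
  ...   | inj₂ y≡v₂ = inj₂ (inj₁ y≡v₂)

  b-exits : ∀ {y} → E (down 0) y → y ≡ down d ⊎ y ≡ down 1 ⊎ y ≡ around 1
  b-exits e with AdjPlus-from-v G {u = a} {v = b} e
  ... | inj₂ y≡a = inj₁ (trans y≡a (sym down-end))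
  ... | inj₁ b~y with D-bare d 1+d<L b~y
  ...   | inj₁ y≡vd   = inj₂ (inj₁ (trans y≡vd (cong v (sym (m+[n∸m]≡n 0<d)))))
  ...   | inj₂ y≡v₂₊d = inj₂ (inj₂ (trans y≡v₂₊d (cong (v ∘ suc) (+-comm 1 d))))

  chord-cycle-length : ∀ {k} (C : UnrolledCycle E (suc k)) → at C 0 ≡ a → at C 1 ≡ b → d < k → k ≡ 2 + e
  chord-cycle-length {k} C C₀ C₁ d<k = ≤-antisym (≮⇒≥ 2+e≮k) (≰⇒> k≰1+e)
    where
    g = next C
    r = reverse (AdjPlus-sym G) C
    gₖ : at g k ≡ a
    gₖ = trans (periodic C 0) C₀
    rₖ : at r k ≡ b
    rₖ = trans (reverse-last (AdjPlus-sym G) C (<-trans 0<d d<k)) C₁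
    g₁ : at g 1 ≡ around 1
    g₁ = exit-off-bare-path g down-bare 0<d d<k (n<1+n k) C₁ (trans gₖ (sym down-end)) b-exits
    r₁ : at r 1 ≡ v 0
    r₁ = exit-off-bare-path r up-bare 0<d d<k (n<1+n k) C₀ rₖ a-exits
    g-around : ∀ {j} → j ≤ suc e → at g j ≡ around j
    g-around = follow-bare {E = E} around-bare (step g) (no-return g (s≤s (<-trans 1<d d<k)))
      (trans C₁ (cong (v ∘ suc) (sym (+-identityʳ d)))) g₁
    k≰1+e : ¬ k ≤ suc e
    k≰1+e k≤1+e = distinct D (s<s (<-≤-trans 0<d (m≤m+n d k)))
      (s<s (s≤s (subst (d + k ≤_) (+-suc d e) (+-monoʳ-≤ d k≤1+e)))) (trans (sym gₖ) (g-around k≤1+e))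
    w-twice : at C (2 + e) ≡ at C k
    w-twice = begin
      at g (suc e)    ≡⟨ g-around ≤-refl ⟩
      around (suc e)  ≡⟨ around-end ⟩
      v 0             ≡⟨ r₁ ⟨
      at C (k + 0)    ≡⟨ cong (at C) (+-identityʳ k) ⟩
      at C k          ∎
    2+e≮k : ¬ 2 + e < k
    2+e≮k 2+e<k = distinct C 2+e<k (<-≤-trans (n<1+n k) (m≤n+m (suc k) (2 + e))) w-twice

  saturated-length : ∀ {k} → Saturated G (suc k) → d < k → k ≡ 2 + e
  saturated-length sat d<k = let (C , C₀ , C₁) = added-edge-cycle G sat a≢b a≁b in chord-cycle-length C C₀ C₁ d<k

saturated⇒¬pendant : ∀ {n k ℓ} (G : Graph n) → Saturated G (suc k) → 4 ≤ k →
  (D : UnrolledCycle (Adj G) (4 + ℓ)) → ¬ Pendant G D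
saturated⇒¬pendant {k = k} {ℓ = zero} G sat 4≤k D pendant = 4≰2 (subst (4 ≤_) chord-2 4≤k)
  where
  chord-2 : k ≡ 2
  chord-2 = Chord.saturated-length G {d = 2} (s≤s (s≤s z≤n)) D pendant sat (≤-trans (n≤1+n 3) 4≤k)
  4≰2 : ¬ 4 ≤ 2
  4≰2 (s≤s (s≤s ()))
saturated⇒¬pendant {k = k} {ℓ = suc ℓ} G sat 4≤k D pendant = 1+n≢n (trans (sym chord-2) chord-3)
  where
  chord-2 : k ≡ 3 + ℓ
  chord-2 = Chord.saturated-length G {d = 2} (s≤s (s≤s z≤n)) D pendant sat (≤-trans (n≤1+n 3) 4≤k)
  chord-3 : k ≡ 2 + ℓ
  chord-3 = Chord.saturated-length G {d = 3} (s≤s (s≤s z≤n)) D pendant sat 4≤k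

lemma4p2 : (k n : ℕ) → 5 ≤ k → (G : Graph n) → Saturated G k →
    (ℓ : ℕ) → 2 ≤ ℓ → (u : Fin (suc ℓ) → Fin n) → IsPath G u →
    (∀ i → degree G (u i) ≡ 2) →
    ¬ (Σ (Fin n) λ w → (∀ i → w ≢ u i) × Adj G w (u zero) × Adj G w (u (fromℕ ℓ)))
lemma4p2 (suc k) n (s≤s 4≤k) G sat (suc (suc ℓ)) (s≤s (s≤s z≤n)) u u-path u-deg (w , w∉u , w~u₀ , w~uℓ) =
  let (D , pendant) = pendant-closure G u-path u-deg w∉u w~u₀ w~uℓ in saturated⇒¬pendant G sat 4≤k D pendant
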